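{- For $Y\subseteq H$ and an abstract transition $\nu$: if a path $\rho$ in $\mathcal S$ is $Y$-just and $\nu$-enabled, then $\ell(\nu)\in Y$.
   Context: ABC: sets $\mathcal A$ (agent identifiers), $\mathcal B$ (broadcast names), $\mathcal C$ (handshake names); $H=\mathcal C\cup\{\bar c\mid c\in\mathcal C\}$, $\bar{\bar c}=c$, $\bar Z=\{\bar c\mid c\in Z\}$; $Act=\mathcal B!\cup\mathcal B?\cup H\cup\{\tau\}$ with $\mathcal B!=\{b!\}$, $\mathcal B?=\{b?\}$. A relabelling $f$ maps $\mathcal B\to\mathcal B$, $\mathcal C\to\mathcal C$, extended by $f(\bar c)=\overline{f(c)}$, $f(b\sharp)=f(b)\sharp$, $f(\tau)=\tau$. Expressions: $0$, $\alpha.E$, $E+F$, $E|F$, $E\backslash c$ ($c\in H$), $E[f]$, $A\in\mathcal A$ with guarded defining equations $A\stackrel{def}{=}P$. Transitions are given by the rules (with $\eta\in H\cup\{\tau\}$): (Act) $\alpha.E\xrightarrow{\alpha}E$; (Sum-l/r) a transition of $E$ (resp. $F$) is a transition of $E+F$; (Par-l/r) $E\xrightarrow{\eta}E'$ gives $E|F\xrightarrow{\eta}E'|F$, and symmetrically; (Comm) $E\xrightarrow{c}E'$, $F\xrightarrow{\bar c}F'$ give $E|F\xrightarrow{\tau}E'|F'$; (Bro-l) $E\xrightarrow{b\sharp_1}E'$ ($\sharp_1\in\{!,?\}$) and $F$ has no $b?$-transition give $E|F\xrightarrow{b\sharp_1}E'|F$; (Bro-r) symmetric; (Bro-c) $E\xrightarrow{b\sharp_1}E'$,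 $F\xrightarrow{b\sharp_2}F'$ give $E|F\xrightarrow{b(\sharp_1\circ\sharp_2)}E'|F'$ with $!\circ?=?\circ!=!$, $?\circ?=?$, $!\circ!$ undefined; (Rel) $E\xrightarrow{\ell}E'$ gives $E[f]\xrightarrow{f(\ell)}E'[f]$; (Res) $E\xrightarrow{\ell}E'$, $\ell\notin\{c,\bar c\}$ give $E\backslash c\xrightarrow{\ell}E'\backslash c$; (Rec) $P\xrightarrow{\ell}E'$, $A\stackrel{def}{=}P$ give $A\xrightarrow{\ell}E'$. $\mathcal S$: states are the expressions and the transitions $t=(P,\alpha,Q)$; edges $P\to t\to Q$. Paths are finite or infinite sequences of states linked by edges, infinite or ending in an expression. Decomposition: each transition $P|Q\xrightarrow{\ell}R$ derives via the rules from either a transition of $P$ and the state $Q$ ($R=P'|Q$), or transitions of both ($R=P'|Q'$), or the state $P$ and a transition of $Q$ ($R=P|Q'$); a decomposition of a path of $P|Q$ into paths $\pi_1$ of $P$, $\pi_2$ of $Q$ chooses one such decomposition per transition and concatenates left, resp. right, components. Transitions of $P[f]$, $P\backslash c$ stem from transitions of $P$, giving decompositions into paths of $P$. $Y$-justness ($Y\subseteq H$) is the largest family of predicates on paths in $\mathcal S$ such that: a finite $Y$-just path ends in an expression all of whose outgoing transitions are labelled in $Y\cup\mathcal B?$; a $Y$-just path of $P|Q$ decomposes into an $X$-just path of $P$ and a $Z$-just path of $Q$ with $X\cup Z\subseteq Y$, $X\cap\bar Z=\emptyset$; a $Y$-just path of $P\backslash c$ decomposes into a $(Y\cup\{c,\bar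 c\})$-just path of $P$; a $Y$-just path of $P[f]$ decomposes into an $f^{ -1}(Y)$-just path of $P$; suffixes of $Y$-just paths are $Y$-just. Derivations of transitions are named: $(\alpha\to P)$ for (Act); $\chi|\zeta$ for (Comm)/(Bro-c); $\chi|Q$ for (Par-l)/(Bro-l); $P|\zeta$ for (Par-r)/(Bro-r); $\chi{+}Q$, $P{+}\chi$, $\chi[f]$, $\chi\backslash c$, $A{:}\chi$ for (Sum-l), (Sum-r), (Rel), (Res), (Rec); $src,target,\ell$ give source, target, label; $\widehat\chi=(src(\chi),\ell(\chi),target(\chi))$. Concurrency $\smile^\bullet$ is the smallest relation on derivations such that (whenever the composed derivations exist): $\chi|Q\smile^\bullet P|\zeta$ and $P|\zeta\smile^\bullet\chi|Q$ if $src(\chi)=P$, $src(\zeta)=Q$; $\chi|\varsigma\smile^\bullet P|\zeta$ and $\varsigma|\chi\smile^\bullet\zeta|P$ if $src(\chi)=P$, $src(\varsigma)=src(\zeta)$, $\ell(\varsigma)\in\mathcal B?$; $\chi\smile^\bullet\zeta$ implies $\chi{+}P\smile^\bullet\zeta{+}P$, $P{+}\chi\smile^\bullet P{+}\zeta$, $\chi|P\smile^\bullet\zeta|P$, $P|\chi\smile^\bullet P|\zeta$; $\chi\smile^\bullet\zeta$ implies $\chi|P\smile^\bullet\zeta|\xi$, $\chi|\xi\smile^\bullet\zeta|P$, $P|\chi\smile^\bullet\xi|\zeta$, $\xi|\chi\smile^\bullet P|\zeta$ if $P=src(\xi)$; $\chi\smile^\bullet\zeta$ implies $\chi|\varsigma\smile^\bullet\zeta|\xi$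 and $\varsigma|\chi\smile^\bullet\xi|\zeta$ if $src(\varsigma)=src(\xi)$, $\ell(\varsigma)\in\mathcal B?$; $\chi\smile^\bullet\zeta$ and $\varsigma\smile^\bullet\xi$ imply $\chi|\varsigma\smile^\bullet\zeta|\xi$; $\chi\smile^\bullet\zeta$ implies $\chi\backslash c\smile^\bullet\zeta\backslash c$, $\chi[f]\smile^\bullet\zeta[f]$, $A{:}\chi\smile^\bullet A{:}\zeta$. $\equiv$ is the smallest equivalence on derivations $\chi$ with $\ell(\chi)\notin\mathcal B?$ such that (whenever derivations exist): $\chi|P\equiv\chi|Q$, $P|\chi\equiv Q|\chi$; $\chi|\varsigma\equiv\chi|P$, $\varsigma|\chi\equiv P|\chi$ if $\ell(\chi)\in\mathcal B!$; $\chi{+}P\equiv\chi\equiv P{+}\chi$, $A{:}\chi\equiv\chi$; $\chi\equiv\zeta$ implies $\chi\backslash c\equiv\zeta\backslash c$, $\chi[f]\equiv\zeta[f]$, $\chi|P\equiv\zeta|P$, $P|\chi\equiv P|\zeta$; $\chi\equiv\zeta$, $\varsigma\equiv\xi$ imply $\chi|\varsigma\equiv\zeta|\xi$. Abstract transitions are the $\equiv$-classes (elements: representatives), with $\ell([\chi]_\equiv)=\ell(\chi)$. $P\models\mathit{en}(\nu)$ for an expression $P$ iff $P=src(\chi)$ for some representative $\chi$ of $\nu$; $\zeta\models\mathit{en}(\nu)$ for a derivation $\zeta$ iff $\chi\smile^\bullet\zeta$ for some representative $\chi$ of $\nu$. A path $\rho$ in $\mathcal S$ is $\nu$-enabled if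 either it is finite and its last state $Q$ satisfies $Q\models\mathit{en}(\nu)$, or it is infinite and has a suffix $\rho'$ such that $\zeta\models\mathit{en}(\nu)$ for every derivation $\zeta$ with $\widehat\zeta$ a transition occurring in $\rho'$. -}

module Defs where

open import Data.Nat using (ℕ; zero; suc; _+_; _∸_; _<_; _≤_; s≤s; z≤n)
open import Data.Nat.Properties using (+-comm)
open import Data.Empty using (⊥)
open import Data.Unit using (⊤)
open import Data.Product using (Σ; ∃; _×_; _,_)
open import Data.Sum using (_⊎_)
open import Data.Bool using (Bool; true; false)
open import Relation.Nullary using (¬_)
open import Relation.Binary.PropositionalEquality using (_≡_; _≢_)

-- Path lengths: finite (number of transitions) or infinite

data Len : Set where
  fin : ℕ → Len
  inf : Len

_<L_ : ℕ → Len → Set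
i <L fin n = i < n
i <L inf   = ⊤

_≤L_ : ℕ → Len → Set
i ≤L fin n = i ≤ n
i ≤L inf   = ⊤

_∸L_ : Len → ℕ → Len
fin n ∸L k = fin (n ∸ k)
inf   ∸L k = inf

private
  +-<-∸ : ∀ n k i → i < n ∸ k → k + i < n
  +-<-∸ zero    zero    i p = p
  +-<-∸ (suc n) zero    i p = p
  +-<-∸ zero    (suc k) i ()
  +-<-∸ (suc n) (suc k) i p = s≤s (+-<-∸ n k i p)

shift-< : ∀ L k i → i <L (L ∸L k) → (i + k) <L L
shift-< (fin n) k i p rewrite +-comm i k = +-<-∸ n k i p
shift-< inf     k i p = p

count : (ℕ → Bool) → ℕ → ℕ
count p zero    = zero
count p (suc i) with p i
... | true  = suc (count p i)
... | false = count p i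

-- The component path π (of length L′) is exactly the concatenation of the
-- components contributed at the indices counted by c, along a path of length L.
Exhausts : Len → (ℕ → ℕ) → Len → Set
Exhausts (fin n) c (fin m) = c n ≡ m
Exhausts (fin n) c inf     = ⊥
Exhausts inf     c (fin m) = ∃ λ k → c k ≡ m
Exhausts inf     c inf     = ∀ m → ∃ λ k → m ≤ c k

module Syntax (𝒜 ℬ 𝒞 : Set) where

  -- H = 𝒞 ∪ {c̄ | c ∈ 𝒞}
  data Hs : Set where
    chan  : 𝒞 → Hs
    cobar : 𝒞 → Hs

  bar : Hs → Hs
  bar (chan c)  = cobar c
  bar (cobar c) = chan c

  data Mode : Set where
    snd rcv : Mode

  -- Act = ℬ! ∪ ℬ? ∪ H ∪ {τ}
  data Label : Set where
    bro : ℬ → Mode → Label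
    hs  : Hs → Label
    τ   : Label

  record Relabelling : Set where
    field
      fB : ℬ → ℬ
      fC : 𝒞 → 𝒞
  open Relabelling public

  relabH : Relabelling → Hs → Hs
  relabH f (chan c)  = chan (fC f c)
  relabH f (cobar c) = cobar (fC f c)

  relab : Relabelling → Label → Label
  relab f (bro b m) = bro (fB f b) m
  relab f (hs h)    = hs (relabH f h)
  relab f τ         = τ

  infixr 30 _∙_
  infixl 20 _⊕_
  infixl 15 _∣_
  data Expr : Set where
    𝟘    : Expr
    _∙_  : Label → Expr → Expr
    _⊕_  : Expr → Expr → Expr
    _∣_  : Expr → Expr → Expr
    _∖_  : Expr → Hs → Expr
    _[_] : Expr → Relabelling → Expr
    ag   : 𝒜 → Expr

  Guarded : Expr → Set
  Guarded 𝟘       = ⊤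
  Guarded (α ∙ E) = ⊤
  Guarded (E ⊕ F) = Guarded E × Guarded F
  Guarded (E ∣ F) = Guarded E × Guarded F
  Guarded (E ∖ c) = Guarded E
  Guarded (E [ f ]) = Guarded E
  Guarded (ag A)  = ⊥

  HSet : Set₁
  HSet = Hs → Set

  -- ℓ ∈ Y  (only handshake labels can lie in Y ⊆ H)
  _∈L_ : Label → HSet → Set
  bro b m ∈L Y = ⊥
  hs h    ∈L Y = Y h
  τ       ∈L Y = ⊥

  _∈L∪ℬ?_ : Label → HSet → Set
  bro b snd ∈L∪ℬ? Y = ⊥
  bro b rcv ∈L∪ℬ? Y = ⊤
  hs h      ∈L∪ℬ? Y = Y h
  τ         ∈L∪ℬ? Y = ⊥

  NotRecv : Label → Set
  NotRecv (bro b snd) = ⊤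
  NotRecv (bro b rcv) = ⊥
  NotRecv (hs h)      = ⊤
  NotRecv τ           = ⊤

  IsSend : Label → Set
  IsSend (bro b snd) = ⊤
  IsSend _           = ⊥

  IsRecv : Label → Set
  IsRecv (bro b rcv) = ⊤
  IsRecv _           = ⊥

  IsEta : Label → Set
  IsEta (bro b m) = ⊥
  IsEta (hs h)    = ⊤
  IsEta τ         = ⊤

  data ModeComb : Mode → Mode → Mode → Set where
    s∘r : ModeComb snd rcv snd
    r∘s : ModeComb rcv snd snd
    r∘r : ModeComb rcv rcv rcv

  data Sync : Label → Label → Label → Set where
    comm  : (c : Hs) → Sync (hs c) (hs (bar c)) τ
    broc  : ∀ {m₁ m₂ m} (b : ℬ) → ModeComb m₁ m₂ m → Sync (bro b m₁) (bro b m₂) (bro b m)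

  _∪_ : HSet → HSet → HSet
  (X ∪ Z) h = X h ⊎ Z h

  _⊆_ : HSet → HSet → Set
  X ⊆ Z = ∀ h → X h → Z h

  -- X ∩ Z̄ = ∅   (h ∈ Z̄ iff h̄ ∈ Z)
  DisjBar : HSet → HSet → Set
  DisjBar X Z = ∀ h → X h → Z (bar h) → ⊥

  addChan : HSet → Hs → HSet
  addChan Y c h = Y h ⊎ (h ≡ c ⊎ h ≡ bar c)

  preimage : Relabelling → HSet → HSet
  preimage f Y h = Y (relabH f h)

module Semantics (𝒜 ℬ 𝒞 : Set) (defs : 𝒜 → Syntax.Expr 𝒜 ℬ 𝒞) where
  open Syntax 𝒜 ℬ 𝒞 public

  variable
    E E′ F F′ P P′ P″ Q Q′ Q″ R R′ : Expr
    ℓ ℓ′ ℓ₁ ℓ₂ ℓ₃ ℓ₄ : Label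

  -- "E has a b?-transition" (defined positively; this is the premise
  -- needed to state the negative side condition of (Bro-l)/(Bro-r))
  data Recv (b : ℬ) : Expr → Set where
    act  : ∀ {E} → Recv b (bro b rcv ∙ E)
    sumL : ∀ {E} F → Recv b E → Recv b (E ⊕ F)
    sumR : ∀ E {F} → Recv b F → Recv b (E ⊕ F)
    parL : ∀ {E} F → Recv b E → Recv b (E ∣ F)
    parR : ∀ E {F} → Recv b F → Recv b (E ∣ F)
    res  : ∀ {E} c → Recv b E → Recv b (E ∖ c)
    rel  : ∀ {E} f {b′} → fB f b′ ≡ b → Recv b′ E → Recv b (E [ f ])
    rec  : ∀ A → Recv b (defs A) → Recv b (ag A)

  data SideOK : Label → Expr → Set where
    eta : ∀ {ℓ F} → IsEta ℓ → SideOK ℓ F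
    brd : ∀ {b m F} → ¬ Recv b F → SideOK (bro b m) F

  data Der : Expr → Label → Expr → Set where
    act  : (α : Label) (E : Expr) → Der (α ∙ E) α E
    sumL : Der E ℓ E′ → (F : Expr) → Der (E ⊕ F) ℓ E′
    sumR : (E : Expr) → Der F ℓ F′ → Der (E ⊕ F) ℓ F′
    parL : Der E ℓ E′ → (F : Expr) → SideOK ℓ F → Der (E ∣ F) ℓ (E′ ∣ F)
    parR : (E : Expr) → Der F ℓ F′ → SideOK ℓ E → Der (E ∣ F) ℓ (E ∣ F′)
    sync : ∀ {ℓ} → Der E ℓ₁ E′ → Der F ℓ₂ F′ → Sync ℓ₁ ℓ₂ ℓ → Der (E ∣ F) ℓ (E′ ∣ F′)
    rel  : Der E ℓ E′ → (f : Relabelling) → Der (E [ f ]) (relab f ℓ) (E′ [ f ])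
    res  : Der E ℓ E′ → (c : Hs) → ℓ ≢ hs c → ℓ ≢ hs (bar c) → Der (E ∖ c) ℓ (E′ ∖ c)
    rec  : (A : 𝒜) → Der (defs A) ℓ E′ → Der (ag A) ℓ E′

  infix 4 _⌣_
  data _⌣_ : Der P ℓ P′ → Der Q ℓ′ Q′ → Set where
    l⌣r : (χ : Der P ℓ₁ P′) (ζ : Der Q ℓ₂ Q′) (o₁ : SideOK ℓ₁ Q) (o₂ : SideOK ℓ₂ P) →
          parL χ Q o₁ ⌣ parR P ζ o₂
    r⌣l : (χ : Der P ℓ₁ P′) (ζ : Der Q ℓ₂ Q′) (o₁ : SideOK ℓ₁ Q) (o₂ : SideOK ℓ₂ P) →
          parR P ζ o₂ ⌣ parL χ Q o₁
    s⌣r : ∀ {ℓ} (χ : Der P ℓ₁ P′) (ς : Der Q ℓ₂ Q′) (ζ : Der Q ℓ₃ Q″) →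
          IsRecv ℓ₂ → (s : Sync ℓ₁ ℓ₂ ℓ) (o : SideOK ℓ₃ P) →
          sync χ ς s ⌣ parR P ζ o
    s⌣l : ∀ {ℓ} (χ : Der P ℓ₁ P′) (ς : Der Q ℓ₂ Q′) (ζ : Der Q ℓ₃ Q″) →
          IsRecv ℓ₂ → (s : Sync ℓ₂ ℓ₁ ℓ) (o : SideOK ℓ₃ P) →
          sync ς χ s ⌣ parL ζ P o
    sumL : {χ : Der P ℓ₁ P′} {ζ : Der Q ℓ₂ Q′} → χ ⌣ ζ → (R : Expr) →
           sumL χ R ⌣ sumL ζ R
    sumR : {χ : Der P ℓ₁ P′} {ζ : Der Q ℓ₂ Q′} → χ ⌣ ζ → (R : Expr) →
           sumR R χ ⌣ sumR R ζ
    parL : {χ : Der P ℓ₁ P′} {ζ : Der Q ℓ₂ Q′} → χ ⌣ ζ → (R : Expr) →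
           (o₁ : SideOK ℓ₁ R) (o₂ : SideOK ℓ₂ R) → parL χ R o₁ ⌣ parL ζ R o₂
    parR : {χ : Der P ℓ₁ P′} {ζ : Der Q ℓ₂ Q′} → χ ⌣ ζ → (R : Expr) →
           (o₁ : SideOK ℓ₁ R) (o₂ : SideOK ℓ₂ R) → parR R χ o₁ ⌣ parR R ζ o₂
    l⌣s : ∀ {ℓ} {χ : Der P ℓ₁ P′} {ζ : Der Q ℓ₂ Q′} → χ ⌣ ζ →
          (ξ : Der R ℓ₃ R′) (o : SideOK ℓ₁ R) (s : Sync ℓ₂ ℓ₃ ℓ) →
          parL χ R o ⌣ sync ζ ξ s
    s⌣l′ : ∀ {ℓ} {χ : Der P ℓ₁ P′} {ζ : Der Q ℓ₂ Q′} → χ ⌣ ζ →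
          (ξ : Der R ℓ₃ R′) (s : Sync ℓ₁ ℓ₃ ℓ) (o : SideOK ℓ₂ R) →
          sync χ ξ s ⌣ parL ζ R o
    r⌣s : ∀ {ℓ} {χ : Der P ℓ₁ P′} {ζ : Der Q ℓ₂ Q′} → χ ⌣ ζ →
          (ξ : Der R ℓ₃ R′) (o : SideOK ℓ₁ R) (s : Sync ℓ₃ ℓ₂ ℓ) →
          parR R χ o ⌣ sync ξ ζ s
    s⌣r′ : ∀ {ℓ} {χ : Der P ℓ₁ P′} {ζ : Der Q ℓ₂ Q′} → χ ⌣ ζ →
          (ξ : Der R ℓ₃ R′) (s : Sync ℓ₃ ℓ₁ ℓ) (o : SideOK ℓ₂ R) →
          sync ξ χ s ⌣ parR R ζ o
    s⌣sL : ∀ {ℓ ℓ″} {χ : Der P ℓ₁ P′} {ζ : Der Q ℓ₂ Q′} → χ ⌣ ζ →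
          (ς : Der R ℓ₃ R′) (ξ : Der R ℓ₄ Q″) → IsRecv ℓ₃ →
          (s : Sync ℓ₁ ℓ₃ ℓ) (s′ : Sync ℓ₂ ℓ₄ ℓ″) →
          sync χ ς s ⌣ sync ζ ξ s′
    s⌣sR : ∀ {ℓ ℓ″} {χ : Der P ℓ₁ P′} {ζ : Der Q ℓ₂ Q′} → χ ⌣ ζ →
          (ς : Der R ℓ₃ R′) (ξ : Der R ℓ₄ Q″) → IsRecv ℓ₃ →
          (s : Sync ℓ₃ ℓ₁ ℓ) (s′ : Sync ℓ₄ ℓ₂ ℓ″) →
          sync ς χ s ⌣ sync ξ ζ s′
    s⌣s : ∀ {E₁ E₁′ F₁ F₁′ ℓ ℓ″ ℓ₅ ℓ₆} {χ : Der P ℓ₁ P′} {ζ : Der Q ℓ₂ Q′}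
          {ς : Der E₁ ℓ₅ E₁′} {ξ : Der F₁ ℓ₆ F₁′} → χ ⌣ ζ → ς ⌣ ξ →
          (s : Sync ℓ₁ ℓ₅ ℓ) (s′ : Sync ℓ₂ ℓ₆ ℓ″) →
          sync χ ς s ⌣ sync ζ ξ s′
    res  : {χ : Der P ℓ₁ P′} {ζ : Der Q ℓ₂ Q′} → χ ⌣ ζ → (c : Hs) →
           (n₁ : ℓ₁ ≢ hs c) (n₂ : ℓ₁ ≢ hs (bar c)) (n₃ : ℓ₂ ≢ hs c) (n₄ : ℓ₂ ≢ hs (bar c)) →
           res χ c n₁ n₂ ⌣ res ζ c n₃ n₄
    rel  : {χ : Der P ℓ₁ P′} {ζ : Der Q ℓ₂ Q′} → χ ⌣ ζ → (f : Relabelling) →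
           rel χ f ⌣ rel ζ f
    rec  : (A : 𝒜) {χ : Der (defs A) ℓ₁ P′} {ζ : Der (defs A) ℓ₂ Q′} → χ ⌣ ζ →
           rec A χ ⌣ rec A ζ

  infix 4 _≡D_
  data _≡D_ : Der P ℓ P′ → Der Q ℓ′ Q′ → Set where
    refl   : (χ : Der P ℓ P′) → NotRecv ℓ → χ ≡D χ
    sym    : {χ : Der P ℓ₁ P′} {ζ : Der Q ℓ₂ Q′} → χ ≡D ζ → ζ ≡D χ
    trans  : ∀ {R₁ R₁′ ℓ₅} {χ : Der P ℓ₁ P′} {ζ : Der Q ℓ₂ Q′} {ξ : Der R₁ ℓ₅ R₁′} →
             χ ≡D ζ → ζ ≡D ξ → χ ≡D ξ
    parL-ctx : (χ : Der E ℓ E′) → NotRecv ℓ → (o₁ : SideOK ℓ P) (o₂ : SideOK ℓ Q) →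
               parL χ P o₁ ≡D parL χ Q o₂
    parR-ctx : (χ : Der E ℓ E′) → NotRecv ℓ → (o₁ : SideOK ℓ P) (o₂ : SideOK ℓ Q) →
               parR P χ o₁ ≡D parR Q χ o₂
    syncL : ∀ {ℓ} (χ : Der E ℓ₁ E′) → IsSend ℓ₁ → (ς : Der F ℓ₂ F′) (s : Sync ℓ₁ ℓ₂ ℓ)
            (o : SideOK ℓ₁ P) → sync χ ς s ≡D parL χ P o
    syncR : ∀ {ℓ} (χ : Der E ℓ₁ E′) → IsSend ℓ₁ → (ς : Der F ℓ₂ F′) (s : Sync ℓ₂ ℓ₁ ℓ)
            (o : SideOK ℓ₁ P) → sync ς χ s ≡D parR P χ o
    sumL : (χ : Der E ℓ E′) → NotRecv ℓ → (P : Expr) → sumL χ P ≡D χ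
    sumR : (χ : Der E ℓ E′) → NotRecv ℓ → (P : Expr) → sumR P χ ≡D χ
    rec  : (A : 𝒜) (χ : Der (defs A) ℓ E′) → NotRecv ℓ → rec A χ ≡D χ
    res-cong : {χ : Der P ℓ₁ P′} {ζ : Der Q ℓ₂ Q′} → χ ≡D ζ → (c : Hs) →
               (n₁ : ℓ₁ ≢ hs c) (n₂ : ℓ₁ ≢ hs (bar c)) (n₃ : ℓ₂ ≢ hs c) (n₄ : ℓ₂ ≢ hs (bar c)) →
               res χ c n₁ n₂ ≡D res ζ c n₃ n₄
    rel-cong : {χ : Der P ℓ₁ P′} {ζ : Der Q ℓ₂ Q′} → χ ≡D ζ → (f : Relabelling) →
               rel χ f ≡D rel ζ f
    parL-cong : {χ : Der P ℓ₁ P′} {ζ : Der Q ℓ₂ Q′} → χ ≡D ζ → (R : Expr) →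
               (o₁ : SideOK ℓ₁ R) (o₂ : SideOK ℓ₂ R) → parL χ R o₁ ≡D parL ζ R o₂
    parR-cong : {χ : Der P ℓ₁ P′} {ζ : Der Q ℓ₂ Q′} → χ ≡D ζ → (R : Expr) →
               (o₁ : SideOK ℓ₁ R) (o₂ : SideOK ℓ₂ R) → parR R χ o₁ ≡D parR R ζ o₂
    sync-cong : ∀ {E₁ E₁′ F₁ F₁′ ℓ ℓ″ ℓ₅ ℓ₆} {χ : Der P ℓ₁ P′} {ζ : Der Q ℓ₂ Q′}
                {ς : Der E₁ ℓ₅ E₁′} {ξ : Der F₁ ℓ₆ F₁′} → χ ≡D ζ → ς ≡D ξ →
                (s : Sync ℓ₁ ℓ₅ ℓ) (s′ : Sync ℓ₂ ℓ₆ ℓ″) →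
                sync χ ς s ≡D sync ζ ξ s′

  -- An abstract transition ν = [χ₀]≡ is given by a representative χ₀
  -- (with ℓ(χ₀) ∉ ℬ?); the representatives of ν are the χ with χ ≡D χ₀.
  record AbsTrans : Set where
    constructor ⟦_,_⟧
    field
      {s₀ t₀} : Expr
      {lab₀}  : Label
      rep     : Der s₀ lab₀ t₀
      rep-ok  : NotRecv lab₀

  ℓν : AbsTrans → Label
  ℓν ν = AbsTrans.lab₀ ν

  EnE : Expr → AbsTrans → Set
  EnE P ν = Σ Label λ ℓ → Σ Expr λ P′ → Σ (Der P ℓ P′) λ χ → χ ≡D AbsTrans.rep ν

  EnD : Der Q ℓ Q′ → AbsTrans → Set
  EnD ζ ν = Σ Expr λ P → Σ Label λ ℓ₀ → Σ Expr λ P′ → Σ (Der P ℓ₀ P′) λ χ →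
              (χ ≡D AbsTrans.rep ν) × (χ ⌣ ζ)

  -- paths in 𝒮 (starting in an expression): states st 0, (st 0, lab 0, st 1),
  -- st 1, … ; finitely many transitions (ending in expression st n) or infinitely many

  record Path : Set where
    field
      len : Len
      st  : ℕ → Expr
      lab : ℕ → Label
      der : ∀ i → i <L len → Der (st i) (lab i) (st (suc i))
  open Path public

  suffix : (ρ : Path) → ℕ → Path
  suffix ρ k = record
    { len = len ρ ∸L k
    ; st  = λ i → st ρ (i + k)
    ; lab = λ i → lab ρ (i + k)
    ; der = λ i p → der ρ (i + k) (shift-< (len ρ) k i p) }

  data IsParL : Der R ℓ R′ → Expr → Label → Expr → Expr → Set where
    isParL : (χ : Der P ℓ P′) (Q : Expr) (o : SideOK ℓ Q) → IsParL (parL χ Q o) P ℓ P′ Q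

  data IsParR : Der R ℓ R′ → Expr → Expr → Label → Expr → Set where
    isParR : (P : Expr) (ζ : Der Q ℓ Q′) (o : SideOK ℓ P) → IsParR (parR P ζ o) P Q ℓ Q′

  data IsSync : Der R ℓ R′ → Expr → Label → Expr → Expr → Label → Expr → Set where
    isSync : ∀ {ℓ} (χ : Der P ℓ₁ P′) (ζ : Der Q ℓ₂ Q′) (s : Sync ℓ₁ ℓ₂ ℓ) →
             IsSync (sync χ ζ s) P ℓ₁ P′ Q ℓ₂ Q′

  data IsRes : Der R ℓ R′ → Expr → Label → Expr → Hs → Set where
    isRes : (χ : Der P ℓ P′) (c : Hs) (n₁ : ℓ ≢ hs c) (n₂ : ℓ ≢ hs (bar c)) →
            IsRes (res χ c n₁ n₂) P ℓ P′ c

  data IsRel : Der R ℓ R′ → Expr → Label → Expr → Relabelling → Set where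
    isRel : (χ : Der P ℓ P′) (f : Relabelling) → IsRel (rel χ f) P ℓ P′ f

  data Tag : Set where
    left both right : Tag

  usesL : Tag → Bool
  usesL right = false
  usesL _     = true

  usesR : Tag → Bool
  usesR left = false
  usesR _    = true

  -- decomposition of a path ρ of π₁-start | π₂-start into π₁ and π₂,
  -- given the choice (tag) of decomposition for each transition of ρ
  module _ (ρ π₁ π₂ : Path) (tag : ℕ → Tag) where
    c₁ c₂ : ℕ → ℕ
    c₁ = count (λ i → usesL (tag i))
    c₂ = count (λ i → usesR (tag i))

    DStep : Tag → ℕ → Set
    DStep left i  = (c₁ i <L len π₁) ×
      Σ (Der (st ρ i) (lab ρ i) (st ρ (suc i))) λ δ →
        IsParL δ (st π₁ (c₁ i)) (lab π₁ (c₁ i)) (st π₁ (suc (c₁ i))) (st π₂ (c₂ i))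
    DStep right i = (c₂ i <L len π₂) ×
      Σ (Der (st ρ i) (lab ρ i) (st ρ (suc i))) λ δ →
        IsParR δ (st π₁ (c₁ i)) (st π₂ (c₂ i)) (lab π₂ (c₂ i)) (st π₂ (suc (c₂ i)))
    DStep both i  = (c₁ i <L len π₁) × (c₂ i <L len π₂) ×
      Σ (Der (st ρ i) (lab ρ i) (st ρ (suc i))) λ δ →
        IsSync δ (st π₁ (c₁ i)) (lab π₁ (c₁ i)) (st π₁ (suc (c₁ i)))
                 (st π₂ (c₂ i)) (lab π₂ (c₂ i)) (st π₂ (suc (c₂ i)))

    record DecompParBy : Set where
      field
        start : st ρ 0 ≡ (st π₁ 0 ∣ st π₂ 0)
        steps : ∀ i → i <L len ρ → DStep (tag i) i
        exhaust₁ : Exhausts (len ρ) c₁ (len π₁)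
        exhaust₂ : Exhausts (len ρ) c₂ (len π₂)

  DecompPar : Path → Path → Path → Set
  DecompPar ρ π₁ π₂ = Σ (ℕ → Tag) λ tag → DecompParBy ρ π₁ π₂ tag

  record DecompRes (ρ : Path) (c : Hs) (π : Path) : Set where
    field
      start : st ρ 0 ≡ (st π 0 ∖ c)
      sameLen : len ρ ≡ len π
      steps : ∀ i → i <L len ρ →
        Σ (Der (st ρ i) (lab ρ i) (st ρ (suc i))) λ δ →
          IsRes δ (st π i) (lab π i) (st π (suc i)) c

  record DecompRel (ρ : Path) (f : Relabelling) (π : Path) : Set where
    field
      start : st ρ 0 ≡ (st π 0 [ f ])
      sameLen : len ρ ≡ len π
      steps : ∀ i → i <L len ρ →
        Σ (Der (st ρ i) (lab ρ i) (st ρ (suc i))) λ δ →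
          IsRel δ (st π i) (lab π i) (st π (suc i)) f

  -- Y-justness: the largest family of predicates satisfying the closure
  -- conditions, i.e. Y-just = member of some family satisfying them

  EndOK : HSet → Path → Set
  EndOK Y ρ with len ρ
  ... | fin n = ∀ ℓ Q → Der (st ρ n) ℓ Q → ℓ ∈L∪ℬ? Y
  ... | inf   = ⊤

  record JustFamily (J : HSet → Path → Set) : Set₁ where
    field
      j-end  : ∀ Y ρ → J Y ρ → EndOK Y ρ
      j-par  : ∀ Y ρ P Q → J Y ρ → st ρ 0 ≡ (P ∣ Q) →
             Σ HSet λ X → Σ HSet λ Z → Σ Path λ π₁ → Σ Path λ π₂ →
               DecompPar ρ π₁ π₂ × J X π₁ × J Z π₂ × ((X ∪ Z) ⊆ Y) × DisjBar X Z
      j-res  : ∀ Y ρ P c → J Y ρ → st ρ 0 ≡ (P ∖ c) →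
             Σ Path λ π → DecompRes ρ c π × J (addChan Y c) π
      j-rel  : ∀ Y ρ P f → J Y ρ → st ρ 0 ≡ (P [ f ]) →
             Σ Path λ π → DecompRel ρ f π × J (preimage f Y) π
      j-suff : ∀ Y ρ k → k ≤L len ρ → J Y ρ → J Y (suffix ρ k)

  Just : HSet → Path → Set₁
  Just Y ρ = Σ (HSet → Path → Set) λ J → JustFamily J × J Y ρ

  Enabled : AbsTrans → Path → Set
  Enabled ν ρ with len ρ
  ... | fin n = EnE (st ρ n) ν
  ... | inf   = Σ ℕ λ k → ∀ i → k ≤ i →
                  (ζ : Der (st ρ i) (lab ρ i) (st ρ (suc i))) → EnD ζ ν

-- Locate every derivation in the parallel structure of its source: at a prefix, on the left or
-- right of a |, at both halves of a handshake, or under ∖ c and [ f ].  Choices, unfoldings and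
-- the passive receivers of a broadcast are forgotten, so ≡-equivalent derivations share a
-- location, and so does ν.  On a finite path the claim is the end condition of justness.  An
-- infinite ν-enabled path is eventually enabled at the location of ν; decomposing it along the
-- top operator of that location gives a component path enabled at the sub-location, to which the
-- end condition (if it is finite) or induction on the location (if it is infinite) applies.  A
-- handshake location cannot occur, since its two halves would put h in X and h̄ in Z.
module Submission where

open import Defs
open import Data.Nat using (ℕ; suc; _+_; _<_)
open import Data.Nat.Properties using (m≤n+m; ≤-pred; m≤n⇒m<n∨m≡n)
open import Data.Empty using (⊥; ⊥-elim)
open import Data.Unit using (⊤; tt)
open import Data.Product using (∃; ∃₂; _×_; _,_; proj₂)
open import Data.Sum using (inj₁; inj₂)
open import Data.Bool using (Bool; true; false)
open import Function using (_∘_)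
open import Relation.Binary.PropositionalEquality as ≡ using (_≡_; _≢_; refl; cong; cong₂; subst)

count-hits : (p : ℕ → Bool) (Q : ℕ → Set) → (∀ i → p i ≡ true → Q (count p i)) →
             ∀ j k → j < count p k → Q j
count-hits p Q hit j (suc k) j<c with p k in pk
... | false = count-hits p Q hit j k j<c
... | true with m≤n⇒m<n∨m≡n (≤-pred j<c)
...   | inj₁ j<ck = count-hits p Q hit j k j<ck
...   | inj₂ refl = hit k pk

module _ (𝒜 ℬ 𝒞 : Set) (defs : 𝒜 → Syntax.Expr 𝒜 ℬ 𝒞) where
  open Semantics 𝒜 ℬ 𝒞 defs

  data Loc : Set where
    prefix     : Label → Loc
    inLeft     : Loc → Loc
    inRight    : Loc → Loc
    handshake  : Loc → Loc → Loc
    reception  : ℬ → Loc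
    restricted : Hs → Loc → Loc
    relabelled : Relabelling → Loc → Loc

  variable
    m n : Loc
    X Y Z : HSet

  locLabel : Loc → Label
  locLabel (prefix α)       = α
  locLabel (inLeft m)       = locLabel m
  locLabel (inRight m)      = locLabel m
  locLabel (handshake _ _)  = τ
  locLabel (reception b)    = bro b rcv
  locLabel (restricted _ m) = locLabel m
  locLabel (relabelled f m) = relab f (locLabel m)

  -- A broadcast received by the other side is located at its sender only, as ≡ demands.
  loc : Der P ℓ P′ → Loc
  loc (act α _)               = prefix α
  loc (sumL χ _)              = loc χ
  loc (sumR _ χ)              = loc χ
  loc (parL χ _ _)            = inLeft (loc χ)
  loc (parR _ χ _)            = inRight (loc χ)
  loc (sync χ ς (comm _))     = handshake (loc χ) (loc ς)
  loc (sync χ _ (broc _ s∘r)) = inLeft (loc χ)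
  loc (sync _ ς (broc _ r∘s)) = inRight (loc ς)
  loc (sync _ _ (broc b r∘r)) = reception b
  loc (rel χ f)               = relabelled f (loc χ)
  loc (res χ c _ _)           = restricted c (loc χ)
  loc (rec _ χ)               = loc χ

  label-loc : (χ : Der P ℓ P′) → ℓ ≡ locLabel (loc χ)
  label-loc (act α _)               = refl
  label-loc (sumL χ _)              = label-loc χ
  label-loc (sumR _ χ)              = label-loc χ
  label-loc (parL χ _ _)            = label-loc χ
  label-loc (parR _ χ _)            = label-loc χ
  label-loc (sync χ ς (comm _))     = refl
  label-loc (sync χ _ (broc _ s∘r)) = label-loc χ
  label-loc (sync _ ς (broc _ r∘s)) = label-loc ς
  label-loc (sync _ _ (broc _ r∘r)) = refl
  label-loc (rel χ f)               = cong (relab f) (label-loc χ)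
  label-loc (res χ _ _ _)           = label-loc χ
  label-loc (rec _ χ)               = label-loc χ

  WellFormed : Loc → Set
  WellFormed (prefix _)        = ⊤
  WellFormed (inLeft m)        = WellFormed m
  WellFormed (inRight m)       = WellFormed m
  WellFormed (handshake m₁ m₂) =
    WellFormed m₁ × WellFormed m₂ × ∃ λ h → locLabel m₁ ≡ hs h × locLabel m₂ ≡ hs (bar h)
  WellFormed (reception _)     = ⊤
  WellFormed (restricted c m)  = WellFormed m × locLabel m ≢ hs c × locLabel m ≢ hs (bar c)
  WellFormed (relabelled _ m)  = WellFormed m

  loc-wellFormed : (χ : Der P ℓ P′) → WellFormed (loc χ)
  loc-wellFormed (act _ _)               = tt
  loc-wellFormed (sumL χ _)              = loc-wellFormed χ
  loc-wellFormed (sumR _ χ)              = loc-wellFormed χ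
  loc-wellFormed (parL χ _ _)            = loc-wellFormed χ
  loc-wellFormed (parR _ χ _)            = loc-wellFormed χ
  loc-wellFormed (sync χ ς (comm h))     =
    loc-wellFormed χ , loc-wellFormed ς , h , ≡.sym (label-loc χ) , ≡.sym (label-loc ς)
  loc-wellFormed (sync χ _ (broc _ s∘r)) = loc-wellFormed χ
  loc-wellFormed (sync _ ς (broc _ r∘s)) = loc-wellFormed ς
  loc-wellFormed (sync _ _ (broc _ r∘r)) = tt
  loc-wellFormed (rel χ _)               = loc-wellFormed χ
  loc-wellFormed (res χ _ ≢c ≢c̄)         =
    loc-wellFormed χ , ≢c ∘ ≡.trans (label-loc χ) , ≢c̄ ∘ ≡.trans (label-loc χ)
  loc-wellFormed (rec _ χ)               = loc-wellFormed χ

  send⇒NotRecv : IsSend ℓ → NotRecv ℓ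
  send⇒NotRecv {ℓ = bro _ snd} _ = tt

  sendˡ⇒NotRecv : IsSend ℓ₁ → Sync ℓ₁ ℓ₂ ℓ → NotRecv ℓ
  sendˡ⇒NotRecv _ (broc _ s∘r) = tt

  sendʳ⇒NotRecv : IsSend ℓ₂ → Sync ℓ₁ ℓ₂ ℓ → NotRecv ℓ
  sendʳ⇒NotRecv _ (broc _ r∘s) = tt

  NotRecv-sync : NotRecv ℓ₁ → NotRecv ℓ₂ → Sync ℓ₁ ℓ₂ ℓ → NotRecv ℓ
  NotRecv-sync _  _  (comm _)       = tt
  NotRecv-sync _  () (broc _ s∘r)
  NotRecv-sync () _  (broc _ r∘s)
  NotRecv-sync () _  (broc _ r∘r)

  NotRecv-relab : ∀ f → NotRecv ℓ → NotRecv (relab f ℓ)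
  NotRecv-relab {ℓ = bro _ snd} _ _ = tt
  NotRecv-relab {ℓ = hs _}      _ _ = tt
  NotRecv-relab {ℓ = τ}         _ _ = tt

  NotRecv-unrelab : ∀ f → NotRecv (relab f ℓ) → NotRecv ℓ
  NotRecv-unrelab {ℓ = bro _ snd} _ _ = tt
  NotRecv-unrelab {ℓ = hs _}      _ _ = tt
  NotRecv-unrelab {ℓ = τ}         _ _ = tt

  ≡D⇒NotRecv : {χ : Der P ℓ P′} {ζ : Der Q ℓ′ Q′} → χ ≡D ζ → NotRecv ℓ × NotRecv ℓ′
  ≡D⇒NotRecv (refl _ r)             = r , r
  ≡D⇒NotRecv (sym e)                = let r , r′ = ≡D⇒NotRecv e in r′ , r
  ≡D⇒NotRecv (trans e e′)           = let r , _ = ≡D⇒NotRecv e; _ , r′ = ≡D⇒NotRecv e′ in r , r′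
  ≡D⇒NotRecv (parL-ctx _ r _ _)     = r , r
  ≡D⇒NotRecv (parR-ctx _ r _ _)     = r , r
  ≡D⇒NotRecv (syncL _ send _ s _)   = sendˡ⇒NotRecv send s , send⇒NotRecv send
  ≡D⇒NotRecv (syncR _ send _ s _)   = sendʳ⇒NotRecv send s , send⇒NotRecv send
  ≡D⇒NotRecv (sumL _ r _)           = r , r
  ≡D⇒NotRecv (sumR _ r _)           = r , r
  ≡D⇒NotRecv (rec _ _ r)            = r , r
  ≡D⇒NotRecv (res-cong e _ _ _ _ _) = ≡D⇒NotRecv e
  ≡D⇒NotRecv (rel-cong e f)         = let r , r′ = ≡D⇒NotRecv e in NotRecv-relab f r , NotRecv-relab f r′
  ≡D⇒NotRecv (parL-cong e _ _ _)    = ≡D⇒NotRecv e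
  ≡D⇒NotRecv (parR-cong e _ _ _)    = ≡D⇒NotRecv e
  ≡D⇒NotRecv (sync-cong e e′ s s′)  =
    let r₁ , r₂ = ≡D⇒NotRecv e; r₁′ , r₂′ = ≡D⇒NotRecv e′
    in NotRecv-sync r₁ r₁′ s , NotRecv-sync r₂ r₂′ s′

  loc-sync : {χ : Der E ℓ₁ E′} {ς : Der F ℓ₂ F′} → NotRecv ℓ₁ → NotRecv ℓ₂ →
             (s : Sync ℓ₁ ℓ₂ ℓ) → loc (sync χ ς s) ≡ handshake (loc χ) (loc ς)
  loc-sync _  _  (comm _)       = refl
  loc-sync _  () (broc _ s∘r)
  loc-sync () _  (broc _ r∘s)
  loc-sync () _  (broc _ r∘r)

  ≡D⇒loc≡ : {χ : Der P ℓ P′} {ζ : Der Q ℓ′ Q′} → χ ≡D ζ → loc χ ≡ loc ζ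
  ≡D⇒loc≡ (refl _ _)                   = refl
  ≡D⇒loc≡ (sym e)                      = ≡.sym (≡D⇒loc≡ e)
  ≡D⇒loc≡ (trans e e′)                 = ≡.trans (≡D⇒loc≡ e) (≡D⇒loc≡ e′)
  ≡D⇒loc≡ (parL-ctx _ _ _ _)           = refl
  ≡D⇒loc≡ (parR-ctx _ _ _ _)           = refl
  ≡D⇒loc≡ (syncL _ _ _ (broc _ s∘r) _) = refl
  ≡D⇒loc≡ (syncR _ _ _ (broc _ r∘s) _) = refl
  ≡D⇒loc≡ (sumL _ _ _)                 = refl
  ≡D⇒loc≡ (sumR _ _ _)                 = refl
  ≡D⇒loc≡ (rec _ _ _)                  = refl
  ≡D⇒loc≡ (res-cong e c _ _ _ _)       = cong (restricted c) (≡D⇒loc≡ e)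
  ≡D⇒loc≡ (rel-cong e f)               = cong (relabelled f) (≡D⇒loc≡ e)
  ≡D⇒loc≡ (parL-cong e _ _ _)          = cong inLeft (≡D⇒loc≡ e)
  ≡D⇒loc≡ (parR-cong e _ _ _)          = cong inRight (≡D⇒loc≡ e)
  ≡D⇒loc≡ (sync-cong e e′ s s′)      =
    let r₁ , r₂ = ≡D⇒NotRecv e; r₁′ , r₂′ = ≡D⇒NotRecv e′
    in ≡.trans (loc-sync r₁ r₁′ s)
               (≡.trans (cong₂ handshake (≡D⇒loc≡ e) (≡D⇒loc≡ e′)) (≡.sym (loc-sync r₂ r₂′ s′)))

  ≡D⇒label≡ : {χ : Der P ℓ P′} {ζ : Der Q ℓ′ Q′} → χ ≡D ζ → ℓ ≡ ℓ′
  ≡D⇒label≡ {χ = χ} {ζ = ζ} e =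
    ≡.trans (label-loc χ) (≡.trans (cong locLabel (≡D⇒loc≡ e)) (≡.sym (label-loc ζ)))

  ⌣-source : {χ : Der P ℓ P′} {ζ : Der Q ℓ′ Q′} → χ ⌣ ζ → P ≡ Q
  ⌣-source (l⌣r _ _ _ _)      = refl
  ⌣-source (r⌣l _ _ _ _)      = refl
  ⌣-source (s⌣r _ _ _ _ _ _)  = refl
  ⌣-source (s⌣l _ _ _ _ _ _)  = refl
  ⌣-source (sumL c _)         = cong (_⊕ _) (⌣-source c)
  ⌣-source (sumR c _)         = cong (_ ⊕_) (⌣-source c)
  ⌣-source (parL c _ _ _)     = cong (_∣ _) (⌣-source c)
  ⌣-source (parR c _ _ _)     = cong (_ ∣_) (⌣-source c)
  ⌣-source (l⌣s c _ _ _)      = cong (_∣ _) (⌣-source c)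
  ⌣-source (s⌣l′ c _ _ _)     = cong (_∣ _) (⌣-source c)
  ⌣-source (r⌣s c _ _ _)      = cong (_ ∣_) (⌣-source c)
  ⌣-source (s⌣r′ c _ _ _)     = cong (_ ∣_) (⌣-source c)
  ⌣-source (s⌣sL c _ _ _ _ _) = cong (_∣ _) (⌣-source c)
  ⌣-source (s⌣sR c _ _ _ _ _) = cong (_ ∣_) (⌣-source c)
  ⌣-source (s⌣s c c′ _ _)     = cong₂ _∣_ (⌣-source c) (⌣-source c′)
  ⌣-source (res c h _ _ _ _)  = cong (_∖ h) (⌣-source c)
  ⌣-source (rel c f)          = cong (_[ f ]) (⌣-source c)
  ⌣-source (rec _ _)          = refl

  TopShape : Loc → Expr → Set
  TopShape (prefix _)       _ = ⊥
  TopShape (restricted c _) E = ∃ λ A → E ≡ (A ∖ c)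
  TopShape (relabelled f _) E = ∃ λ A → E ≡ (A [ f ])
  TopShape _                E = ∃₂ λ A B → E ≡ (A ∣ B)

  sync-shape : {χ : Der E ℓ₁ E′} {ς : Der F ℓ₂ F′} (s : Sync ℓ₁ ℓ₂ ℓ) →
               TopShape (loc (sync χ ς s)) (P ∣ Q)
  sync-shape (comm _)     = _ , _ , refl
  sync-shape (broc _ s∘r) = _ , _ , refl
  sync-shape (broc _ r∘s) = _ , _ , refl
  sync-shape (broc _ r∘r) = _ , _ , refl

  -- Sums and unfoldings vanish in targets, so it is the target of ζ, not the common source,
  -- that has the top-level form of the location.
  ⌣-target-shape : {χ : Der P ℓ P′} {ζ : Der Q ℓ′ Q′} → χ ⌣ ζ → TopShape (loc χ) Q′
  ⌣-target-shape (l⌣r _ _ _ _)      = _ , _ , refl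
  ⌣-target-shape (r⌣l _ _ _ _)      = _ , _ , refl
  ⌣-target-shape (s⌣r _ _ _ _ s _)  = sync-shape s
  ⌣-target-shape (s⌣l _ _ _ _ s _)  = sync-shape s
  ⌣-target-shape (sumL c _)         = ⌣-target-shape c
  ⌣-target-shape (sumR c _)         = ⌣-target-shape c
  ⌣-target-shape (parL _ _ _ _)     = _ , _ , refl
  ⌣-target-shape (parR _ _ _ _)     = _ , _ , refl
  ⌣-target-shape (l⌣s _ _ _ _)      = _ , _ , refl
  ⌣-target-shape (s⌣l′ _ _ s _)     = sync-shape s
  ⌣-target-shape (r⌣s _ _ _ _)      = _ , _ , refl
  ⌣-target-shape (s⌣r′ _ _ s _)     = sync-shape s
  ⌣-target-shape (s⌣sL _ _ _ _ s _) = sync-shape s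
  ⌣-target-shape (s⌣sR _ _ _ _ s _) = sync-shape s
  ⌣-target-shape (s⌣s _ _ s _)      = sync-shape s
  ⌣-target-shape (res _ _ _ _ _ _)  = _ , refl
  ⌣-target-shape (rel _ _)          = _ , refl
  ⌣-target-shape (rec _ c)          = ⌣-target-shape c

  data LeftPart : Der (P ∣ Q) ℓ R → Der P ℓ₁ P′ → Set where
    viaParL : (χ : Der P ℓ P′) (o : SideOK ℓ Q) → LeftPart (parL χ Q o) χ
    viaSync : (χ : Der P ℓ₁ P′) (ς : Der Q ℓ₂ Q′) (s : Sync ℓ₁ ℓ₂ ℓ) → LeftPart (sync χ ς s) χ

  data RightPart : Der (P ∣ Q) ℓ R → Der Q ℓ₂ Q′ → Set where
    viaParR : (ς : Der Q ℓ Q′) (o : SideOK ℓ P) → RightPart (parR P ς o) ς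
    viaSync : (χ : Der P ℓ₁ P′) (ς : Der Q ℓ₂ Q′) (s : Sync ℓ₁ ℓ₂ ℓ) → RightPart (sync χ ς s) ς

  receive-NotRecv : IsRecv ℓ → NotRecv ℓ → ⊥
  receive-NotRecv {ℓ = bro _ rcv} _ ()

  ⌣-left-part : {χ : Der (P ∣ Q) ℓ R} {ζ : Der (P ∣ Q) ℓ′ R′}
                {χ₁ : Der P ℓ₁ P′} {ζ₁ : Der P ℓ₂ P″} →
                LeftPart χ χ₁ → NotRecv ℓ₁ → LeftPart ζ ζ₁ → χ ⌣ ζ → χ₁ ⌣ ζ₁
  ⌣-left-part (viaParL _ _)   _ (viaParL _ _)   (parL c _ _ _)        = c
  ⌣-left-part (viaParL _ _)   _ (viaSync _ _ _) (l⌣s c _ _ _)         = c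
  ⌣-left-part (viaSync _ _ _) r (viaParL _ _)   (s⌣l _ _ _ recv _ _)  = ⊥-elim (receive-NotRecv recv r)
  ⌣-left-part (viaSync _ _ _) _ (viaParL _ _)   (s⌣l′ c _ _ _)        = c
  ⌣-left-part (viaSync _ _ _) _ (viaSync _ _ _) (s⌣sL c _ _ _ _ _)    = c
  ⌣-left-part (viaSync _ _ _) r (viaSync _ _ _) (s⌣sR _ _ _ recv _ _) = ⊥-elim (receive-NotRecv recv r)
  ⌣-left-part (viaSync _ _ _) _ (viaSync _ _ _) (s⌣s c _ _ _)         = c

  ⌣-right-part : {χ : Der (P ∣ Q) ℓ R} {ζ : Der (P ∣ Q) ℓ′ R′}
                 {χ₂ : Der Q ℓ₁ Q′} {ζ₂ : Der Q ℓ₂ Q″} →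
                 RightPart χ χ₂ → NotRecv ℓ₁ → RightPart ζ ζ₂ → χ ⌣ ζ → χ₂ ⌣ ζ₂
  ⌣-right-part (viaParR _ _)   _ (viaParR _ _)   (parR c _ _ _)        = c
  ⌣-right-part (viaParR _ _)   _ (viaSync _ _ _) (r⌣s c _ _ _)         = c
  ⌣-right-part (viaSync _ _ _) r (viaParR _ _)   (s⌣r _ _ _ recv _ _)  = ⊥-elim (receive-NotRecv recv r)
  ⌣-right-part (viaSync _ _ _) _ (viaParR _ _)   (s⌣r′ c _ _ _)        = c
  ⌣-right-part (viaSync _ _ _) r (viaSync _ _ _) (s⌣sL _ _ _ recv _ _) = ⊥-elim (receive-NotRecv recv r)
  ⌣-right-part (viaSync _ _ _) _ (viaSync _ _ _) (s⌣sR c _ _ _ _ _)    = c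
  ⌣-right-part (viaSync _ _ _) _ (viaSync _ _ _) (s⌣s _ c _ _)         = c

  data LeftComponent : Loc → Loc → Set where
    inLeftˡ    : ∀ m → LeftComponent (inLeft m) m
    handshakeˡ : ∀ m₁ m₂ → LeftComponent (handshake m₁ m₂) m₁

  data RightComponent : Loc → Loc → Set where
    inRightʳ   : ∀ m → RightComponent (inRight m) m
    handshakeʳ : ∀ m₁ m₂ → RightComponent (handshake m₁ m₂) m₂

  data LeftPartAt (m : Loc) (χ : Der (P ∣ Q) ℓ R) : Set where
    leftPartAt : (χ₁ : Der P ℓ₁ P′) → LeftPart χ χ₁ → loc χ₁ ≡ m → LeftPartAt m χ

  data RightPartAt (m : Loc) (χ : Der (P ∣ Q) ℓ R) : Set where
    rightPartAt : (χ₂ : Der Q ℓ₂ Q′) → RightPart χ χ₂ → loc χ₂ ≡ m → RightPartAt m χ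

  left-part : (χ : Der (P ∣ Q) ℓ R) → LeftComponent (loc χ) m → LeftPartAt m χ
  left-part (parL χ _ o)              (inLeftˡ _)      = leftPartAt χ (viaParL χ o) refl
  left-part (parR _ _ _)              ()
  left-part (sync χ ς s@(comm _))     (handshakeˡ _ _) = leftPartAt χ (viaSync χ ς s) refl
  left-part (sync χ ς s@(broc _ s∘r)) (inLeftˡ _)      = leftPartAt χ (viaSync χ ς s) refl
  left-part (sync _ _ (broc _ r∘s))   ()
  left-part (sync _ _ (broc _ r∘r))   ()

  right-part : (χ : Der (P ∣ Q) ℓ R) → RightComponent (loc χ) m → RightPartAt m χ
  right-part (parL _ _ _)              ()
  right-part (parR _ ς o)              (inRightʳ _)     = rightPartAt ς (viaParR ς o) refl
  right-part (sync χ ς s@(comm _))     (handshakeʳ _ _) = rightPartAt ς (viaSync χ ς s) refl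
  right-part (sync _ _ (broc _ s∘r))   ()
  right-part (sync χ ς s@(broc _ r∘s)) (inRightʳ _)     = rightPartAt ς (viaSync χ ς s) refl
  right-part (sync _ _ (broc _ r∘r))   ()

  data ConcurrentAt (m : Loc) (ζ : Der P ℓ P′) : Set where
    concurrentAt : (χ : Der P ℓ′ P″) → loc χ ≡ m → χ ⌣ ζ → ConcurrentAt m ζ

  EnabledAt : Loc → Expr → Label → Expr → Set
  EnabledAt m P ℓ P′ = (ζ : Der P ℓ P′) → ConcurrentAt m ζ

  StepEnabledAt : Loc → Path → ℕ → Set
  StepEnabledAt m ρ i = EnabledAt m (st ρ i) (lab ρ i) (st ρ (suc i))

  PathEnabledAt : Loc → Path → Set
  PathEnabledAt m ρ = ∀ i → StepEnabledAt m ρ i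

  NotRecv-loc : (χ : Der P ℓ P′) → NotRecv (locLabel (loc χ)) → NotRecv ℓ
  NotRecv-loc χ = subst NotRecv (≡.sym (label-loc χ))

  enabledAt-left : LeftComponent n m → NotRecv (locLabel m) →
                   (lift : Der P ℓ₁ P′ → Der (P ∣ Q) ℓ R) → (∀ ζ → LeftPart (lift ζ) ζ) →
                   EnabledAt n (P ∣ Q) ℓ R → EnabledAt m P ℓ₁ P′
  enabledAt-left lc r lift part en ζ with en (lift ζ)
  ... | concurrentAt χ refl χ⌣ with left-part χ lc
  ... | leftPartAt χ₁ p refl = concurrentAt χ₁ refl (⌣-left-part p (NotRecv-loc χ₁ r) (part ζ) χ⌣)

  enabledAt-right : RightComponent n m → NotRecv (locLabel m) →
                    (lift : Der Q ℓ₂ Q′ → Der (P ∣ Q) ℓ R) → (∀ ζ → RightPart (lift ζ) ζ) →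
                    EnabledAt n (P ∣ Q) ℓ R → EnabledAt m Q ℓ₂ Q′
  enabledAt-right rc r lift part en ζ with en (lift ζ)
  ... | concurrentAt χ refl χ⌣ with right-part χ rc
  ... | rightPartAt χ₂ p refl = concurrentAt χ₂ refl (⌣-right-part p (NotRecv-loc χ₂ r) (part ζ) χ⌣)

  module _ {δ : Der R ℓ R′} where

    enabledAt-parL : LeftComponent n m → NotRecv (locLabel m) →
                     IsParL δ P ℓ₁ P′ Q → EnabledAt n R ℓ R′ → EnabledAt m P ℓ₁ P′
    enabledAt-parL lc r (isParL _ Q o) = enabledAt-left lc r (λ ζ → parL ζ Q o) (λ ζ → viaParL ζ o)

    enabledAt-syncL : LeftComponent n m → NotRecv (locLabel m) →
                      IsSync δ P ℓ₁ P′ Q ℓ₂ Q′ → EnabledAt n R ℓ R′ → EnabledAt m P ℓ₁ P′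
    enabledAt-syncL lc r (isSync _ ς s) = enabledAt-left lc r (λ ζ → sync ζ ς s) (λ ζ → viaSync ζ ς s)

    enabledAt-parR : RightComponent n m → NotRecv (locLabel m) →
                     IsParR δ P Q ℓ₂ Q′ → EnabledAt n R ℓ R′ → EnabledAt m Q ℓ₂ Q′
    enabledAt-parR rc r (isParR P _ o) = enabledAt-right rc r (λ ζ → parR P ζ o) (λ ζ → viaParR ζ o)

    enabledAt-syncR : RightComponent n m → NotRecv (locLabel m) →
                      IsSync δ P ℓ₁ P′ Q ℓ₂ Q′ → EnabledAt n R ℓ R′ → EnabledAt m Q ℓ₂ Q′
    enabledAt-syncR rc r (isSync χ _ s) = enabledAt-right rc r (λ ζ → sync χ ζ s) (λ ζ → viaSync χ ζ s)

    enabledAt-res : ∀ {c} → IsRes δ P ℓ₁ P′ c → EnabledAt (restricted c m) R ℓ R′ → EnabledAt m P ℓ₁ P′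
    enabledAt-res (isRes _ c ≢c ≢c̄) en ζ with en (res ζ c ≢c ≢c̄)
    ... | concurrentAt _ refl (res {χ = χ} χ⌣ _ _ _ _ _) = concurrentAt χ refl χ⌣

    enabledAt-rel : ∀ {f} → IsRel δ P ℓ₁ P′ f → EnabledAt (relabelled f m) R ℓ R′ → EnabledAt m P ℓ₁ P′
    enabledAt-rel (isRel _ f) en ζ with en (rel ζ f)
    ... | concurrentAt _ refl (rel {χ = χ} χ⌣ _) = concurrentAt χ refl χ⌣

  Infinite : Path → Set
  Infinite ρ = len ρ ≡ inf

  <L-inf : ∀ {L} i → L ≡ inf → i <L L
  <L-inf _ refl = tt

  ≤L-inf : ∀ {L} i → L ≡ inf → i ≤L L
  ≤L-inf _ refl = tt

  suffix-infinite : ∀ ρ k → Infinite ρ → Infinite (suffix ρ k)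
  suffix-infinite ρ _ ρ-inf rewrite ρ-inf = refl

  suffix-enabledAt : ∀ m ρ k → PathEnabledAt m ρ → PathEnabledAt m (suffix ρ k)
  suffix-enabledAt _ _ k en i = en (i + k)

  target-shape : ∀ m ρ → Infinite ρ → PathEnabledAt m ρ → TopShape m (st ρ 1)
  target-shape _ ρ ρ-inf en with en 0 (der ρ 0 (<L-inf 0 ρ-inf))
  ... | concurrentAt _ refl χ⌣ = ⌣-target-shape χ⌣

  ∈L∪ℬ?⇒∈L : NotRecv ℓ → ℓ ∈L∪ℬ? Y → ℓ ∈L Y
  ∈L∪ℬ?⇒∈L {ℓ = hs _}      _  y = y
  ∈L∪ℬ?⇒∈L {ℓ = bro _ rcv} () _

  final-label∈ : ∀ {ρ n} → len ρ ≡ fin n → EndOK Y ρ → Der (st ρ n) ℓ Q → NotRecv ℓ → ℓ ∈L Y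
  final-label∈ {ρ = ρ} ρ-fin end χ r with len ρ | ρ-fin
  ... | fin _ | refl = ∈L∪ℬ?⇒∈L r (end _ _ χ)

  ∈L-∪ˡ : ∀ ℓ → (X ∪ Z) ⊆ Y → ℓ ∈L X → ℓ ∈L Y
  ∈L-∪ˡ (hs h) X∪Z⊆Y = X∪Z⊆Y h ∘ inj₁

  ∈L-∪ʳ : ∀ ℓ → (X ∪ Z) ⊆ Y → ℓ ∈L Z → ℓ ∈L Y
  ∈L-∪ʳ (hs h) X∪Z⊆Y = X∪Z⊆Y h ∘ inj₂

  ∈L-addChan : ∀ {c} → ℓ ≢ hs c → ℓ ≢ hs (bar c) → ℓ ∈L addChan Y c → ℓ ∈L Y
  ∈L-addChan {ℓ = hs _} _   _   (inj₁ y)        = y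
  ∈L-addChan {ℓ = hs _} ≢c  _   (inj₂ (inj₁ refl)) = ⊥-elim (≢c refl)
  ∈L-addChan {ℓ = hs _} _   ≢c̄  (inj₂ (inj₂ refl)) = ⊥-elim (≢c̄ refl)

  ∈L-preimage : ∀ f ℓ → ℓ ∈L preimage f Y → relab f ℓ ∈L Y
  ∈L-preimage _ (hs (chan _))  y = y
  ∈L-preimage _ (hs (cobar _)) y = y

  DecompRes-infinite : ∀ {ρ c π} → DecompRes ρ c π → Infinite ρ → Infinite π
  DecompRes-infinite d = ≡.trans (≡.sym (DecompRes.sameLen d))

  DecompRes-enabledAt : ∀ {ρ c π} → DecompRes ρ c π → Infinite ρ →
                        PathEnabledAt (restricted c m) ρ → PathEnabledAt m π
  DecompRes-enabledAt d ρ-inf en i = enabledAt-res (proj₂ (DecompRes.steps d i (<L-inf i ρ-inf))) (en i)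

  DecompRel-infinite : ∀ {ρ f π} → DecompRel ρ f π → Infinite ρ → Infinite π
  DecompRel-infinite d = ≡.trans (≡.sym (DecompRel.sameLen d))

  DecompRel-enabledAt : ∀ {ρ f π} → DecompRel ρ f π → Infinite ρ →
                        PathEnabledAt (relabelled f m) ρ → PathEnabledAt m π
  DecompRel-enabledAt d ρ-inf en i = enabledAt-rel (proj₂ (DecompRel.steps d i (<L-inf i ρ-inf))) (en i)

  module _ {δ : Der R ℓ R′} where

    IsParL-source : IsParL δ P ℓ₁ P′ Q → R ≡ (P ∣ Q)
    IsParL-source (isParL _ _ _) = refl

    IsParR-source : IsParR δ P Q ℓ₂ Q′ → R ≡ (P ∣ Q)
    IsParR-source (isParR _ _ _) = refl

    IsSync-source : IsSync δ P ℓ₁ P′ Q ℓ₂ Q′ → R ≡ (P ∣ Q)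
    IsSync-source (isSync _ _ _) = refl

  DStep-source : ∀ {ρ π₁ π₂ tag i} t → DStep ρ π₁ π₂ tag t i →
                 st ρ i ≡ (st π₁ (c₁ ρ π₁ π₂ tag i) ∣ st π₂ (c₂ ρ π₁ π₂ tag i))
  DStep-source left  (_ , _ , p)     = IsParL-source p
  DStep-source right (_ , _ , p)     = IsParR-source p
  DStep-source both  (_ , _ , _ , p) = IsSync-source p

  left-derivation : LeftComponent n m → R ≡ (P ∣ Q) → (χ : Der R ℓ R′) → loc χ ≡ n →
                    ∃ λ P′ → Der P (locLabel m) P′
  left-derivation lc refl χ refl with left-part χ lc
  ... | leftPartAt χ₁ _ refl = _ , subst (λ ℓ → Der _ ℓ _) (label-loc χ₁) χ₁

  right-derivation : RightComponent n m → R ≡ (P ∣ Q) → (χ : Der R ℓ R′) → loc χ ≡ n →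
                     ∃ λ Q′ → Der Q (locLabel m) Q′
  right-derivation rc refl χ refl with right-part χ rc
  ... | rightPartAt χ₂ _ refl = _ , subst (λ ℓ → Der _ ℓ _) (label-loc χ₂) χ₂

  module Components {ρ π₁ π₂ : Path} {tag : ℕ → Tag} (dec : DecompParBy ρ π₁ π₂ tag)
                    (ρ-inf : Infinite ρ) (en : PathEnabledAt n ρ) where

    step : ∀ i → DStep ρ π₁ π₂ tag (tag i) i
    step i = DecompParBy.steps dec i (<L-inf i ρ-inf)

    left-able : LeftComponent n m → ∀ k → ∃ λ P′ → Der (st π₁ (c₁ ρ π₁ π₂ tag k)) (locLabel m) P′
    left-able lc k with concurrentAt χ e _ ← en k (der ρ k (<L-inf k ρ-inf)) =
      left-derivation lc (DStep-source (tag k) (step k)) χ e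

    right-able : RightComponent n m → ∀ k → ∃ λ Q′ → Der (st π₂ (c₂ ρ π₁ π₂ tag k)) (locLabel m) Q′
    right-able rc k with concurrentAt χ e _ ← en k (der ρ k (<L-inf k ρ-inf)) =
      right-derivation rc (DStep-source (tag k) (step k)) χ e

    left-enabledAt : LeftComponent n m → NotRecv (locLabel m) →
                     ∀ i → usesL (tag i) ≡ true → StepEnabledAt m π₁ (c₁ ρ π₁ π₂ tag i)
    left-enabledAt lc r i _ with tag i | step i
    ... | left | _ , _ , p     = enabledAt-parL lc r p (en i)
    ... | both | _ , _ , _ , p = enabledAt-syncL lc r p (en i)

    right-enabledAt : RightComponent n m → NotRecv (locLabel m) →
                      ∀ i → usesR (tag i) ≡ true → StepEnabledAt m π₂ (c₂ ρ π₁ π₂ tag i)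
    right-enabledAt rc r i _ with tag i | step i
    ... | right | _ , _ , p     = enabledAt-parR rc r p (en i)
    ... | both  | _ , _ , _ , p = enabledAt-syncR rc r p (en i)

  module _ {J : HSet → Path → Set} (fam : JustFamily J) where
    open JustFamily fam

    j-tail : ∀ Y ρ → Infinite ρ → J Y ρ → J Y (suffix ρ 1)
    j-tail Y ρ ρ-inf = j-suff Y ρ 1 (≤L-inf 1 ρ-inf)

    Claim : Loc → Set₁
    Claim m = ∀ Y ρ → Infinite ρ → J Y ρ → PathEnabledAt m ρ → locLabel m ∈L Y

    component-label∈ : Claim m → NotRecv (locLabel m) → (π : Path) (u : ℕ → Bool) →
                       Exhausts inf (count u) (len π) → J X π →
                       (∀ k → ∃ λ P′ → Der (st π (count u k)) (locLabel m) P′) →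
                       (∀ i → u i ≡ true → StepEnabledAt m π (count u i)) →
                       locLabel m ∈L X
    component-label∈ {m = m} ih r π u exhausts jπ able enabled with len π in π-len | exhausts
    ... | fin _ | k , refl = final-label∈ π-len (j-end _ π jπ) (proj₂ (able k)) r
    ... | inf   | unbounded =
      ih _ π π-len jπ λ j → let k , j<count = unbounded (suc j) in
                            count-hits u (StepEnabledAt m π) enabled j k j<count

    module ComponentLabels {ρ π₁ π₂ : Path} {tag : ℕ → Tag} (dec : DecompParBy ρ π₁ π₂ tag)
                           (ρ-inf : Infinite ρ) (en : PathEnabledAt n ρ) where
      open Components dec ρ-inf en

      left-label∈ : LeftComponent n m → NotRecv (locLabel m) → Claim m → J X π₁ → locLabel m ∈L X
      left-label∈ lc r ih jX =
        component-label∈ ih r π₁ (usesL ∘ tag) (subst (λ L → Exhausts L _ _) ρ-inf (DecompParBy.exhaust₁ dec))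
                         jX (left-able lc) (left-enabledAt lc r)

      right-label∈ : RightComponent n m → NotRecv (locLabel m) → Claim m → J Z π₂ → locLabel m ∈L Z
      right-label∈ rc r ih jZ =
        component-label∈ ih r π₂ (usesR ∘ tag) (subst (λ L → Exhausts L _ _) ρ-inf (DecompParBy.exhaust₂ dec))
                         jZ (right-able rc) (right-enabledAt rc r)

    -- The tail suffix ρ 1 starts with the top operator of the location, so the justness family
    -- decomposes it into a path enabled at a sub-location.
    claim : ∀ m → WellFormed m → NotRecv (locLabel m) → Claim m
    claim (prefix α) _ _ _ ρ ρ-inf _ en = ⊥-elim (target-shape (prefix α) ρ ρ-inf en)
    claim (reception _) _ ()
    claim (inLeft m) wf r Y ρ ρ-inf jY en
      with A , B , split ← target-shape (inLeft m) ρ ρ-inf en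
      with _ , _ , _ , _ , (_ , dec) , jX , _ , ⊆Y , _ ← j-par Y (suffix ρ 1) A B (j-tail Y ρ ρ-inf jY) split
      = ∈L-∪ˡ (locLabel m) ⊆Y (left-label∈ (inLeftˡ m) r (claim m wf r) jX)
      where open ComponentLabels dec (suffix-infinite ρ 1 ρ-inf) (suffix-enabledAt (inLeft m) ρ 1 en)
    claim (inRight m) wf r Y ρ ρ-inf jY en
      with A , B , split ← target-shape (inRight m) ρ ρ-inf en
      with _ , _ , _ , _ , (_ , dec) , _ , jZ , ⊆Y , _ ← j-par Y (suffix ρ 1) A B (j-tail Y ρ ρ-inf jY) split
      = ∈L-∪ʳ (locLabel m) ⊆Y (right-label∈ (inRightʳ m) r (claim m wf r) jZ)
      where open ComponentLabels dec (suffix-infinite ρ 1 ρ-inf) (suffix-enabledAt (inRight m) ρ 1 en)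
    claim (handshake m₁ m₂) (wf₁ , wf₂ , h , ℓ₁≡h , ℓ₂≡h̄) _ Y ρ ρ-inf jY en
      with A , B , split ← target-shape (handshake m₁ m₂) ρ ρ-inf en
      with X , Z , _ , _ , (_ , dec) , jX , jZ , _ , X∩Z̄≡∅ ← j-par Y (suffix ρ 1) A B (j-tail Y ρ ρ-inf jY) split
      = X∩Z̄≡∅ h (subst (_∈L X) ℓ₁≡h (left-label∈ (handshakeˡ m₁ m₂) r₁ (claim m₁ wf₁ r₁) jX))
                (subst (_∈L Z) ℓ₂≡h̄ (right-label∈ (handshakeʳ m₁ m₂) r₂ (claim m₂ wf₂ r₂) jZ))
      where
      open ComponentLabels dec (suffix-infinite ρ 1 ρ-inf) (suffix-enabledAt (handshake m₁ m₂) ρ 1 en)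
      r₁ : NotRecv (locLabel m₁)
      r₁ = subst NotRecv (≡.sym ℓ₁≡h) tt
      r₂ : NotRecv (locLabel m₂)
      r₂ = subst NotRecv (≡.sym ℓ₂≡h̄) tt
    claim (restricted c m) (wf , ≢c , ≢c̄) r Y ρ ρ-inf jY en
      with A , split ← target-shape (restricted c m) ρ ρ-inf en
      with π , d , jπ ← j-res Y (suffix ρ 1) A c (j-tail Y ρ ρ-inf jY) split
      = ∈L-addChan ≢c ≢c̄ (claim m wf r (addChan Y c) π (DecompRes-infinite d ρ′-inf) jπ
                                 (DecompRes-enabledAt d ρ′-inf (suffix-enabledAt (restricted c m) ρ 1 en)))
      where ρ′-inf = suffix-infinite ρ 1 ρ-inf
    claim (relabelled f m) wf r Y ρ ρ-inf jY en
      with A , split ← target-shape (relabelled f m) ρ ρ-inf en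
      with π , d , jπ ← j-rel Y (suffix ρ 1) A f (j-tail Y ρ ρ-inf jY) split
      = ∈L-preimage f (locLabel m) (claim m wf (NotRecv-unrelab f r) (preimage f Y) π (DecompRel-infinite d ρ′-inf) jπ
                             (DecompRel-enabledAt d ρ′-inf (suffix-enabledAt (relabelled f m) ρ 1 en)))
      where ρ′-inf = suffix-infinite ρ 1 ρ-inf

  EnD⇒ConcurrentAt : ∀ ν {ζ : Der Q ℓ Q′} → EnD ζ ν → ConcurrentAt (loc (AbsTrans.rep ν)) ζ
  EnD⇒ConcurrentAt _ (_ , _ , _ , χ , χ≡rep , χ⌣ζ) with refl ← ⌣-source χ⌣ζ =
    concurrentAt χ (≡D⇒loc≡ χ≡rep) χ⌣ζ

  just∧enabled⇒label∈ : ∀ Y ν ρ → Just Y ρ → Enabled ν ρ → ℓν ν ∈L Y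
  just∧enabled⇒label∈ Y ν@(⟦ rep , rep-ok ⟧) ρ (_ , fam , jY) en with len ρ in ρ-len | en
  ... | fin _ | _ , _ , χ , χ≡rep =
    let ℓ≡ = ≡D⇒label≡ χ≡rep in
    subst (_∈L Y) ℓ≡ (final-label∈ ρ-len (j-end Y ρ jY) χ (subst NotRecv (≡.sym ℓ≡) rep-ok))
    where open JustFamily fam
  ... | inf   | k , eventually =
    subst (_∈L Y) (≡.sym (label-loc rep))
      (claim fam (loc rep) (loc-wellFormed rep) (subst NotRecv (label-loc rep) rep-ok)
             Y (suffix ρ k) (suffix-infinite ρ k ρ-len) (j-suff Y ρ k (≤L-inf k ρ-len) jY)
             λ i ζ → EnD⇒ConcurrentAt ν (eventually (i + k) (m≤n+m k i) ζ))
    where open JustFamily fam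

lemma13 : (𝒜 ℬ 𝒞 : Set) (defs : 𝒜 → Syntax.Expr 𝒜 ℬ 𝒞) →
          (∀ A → Syntax.Guarded 𝒜 ℬ 𝒞 (defs A)) →
          let open Semantics 𝒜 ℬ 𝒞 defs in
          (Y : HSet) (ν : AbsTrans) (ρ : Path) →
          Just Y ρ → Enabled ν ρ → ℓν ν ∈L Y
lemma13 𝒜 ℬ 𝒞 defs _ = just∧enabled⇒label∈ 𝒜 ℬ 𝒞 defs
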